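{- For all $M,n\in\mathbb N$ with $M>1$ or $n>1$, $$A(n,M)=\varphi(M)\sum_{d\mid M} A(n-1,d)\left(\frac{M}{d}\right)^{n-1},$$ where the sum runs over the positive divisors $d$ of $M$.
   Context: Let $\chi:\mathbb Q\to\mathbb Q$ be defined by $\chi(x)=x\lceil x\rceil$, where $\lceil x\rceil$ is the smallest integer greater than or equal to $x$. For $x\in\mathbb Q$, $\mathrm{ord}(x)=\min\{k\in\mathbb N_0:\chi^k(x)\in\mathbb Z\}$ if this set is nonempty, and $\mathrm{ord}(x)=\infty$ otherwise ($\mathbb N=\{1,2,\dots\}$, $\mathbb N_0=\mathbb N\cup\{0\}$). For $n\in\mathbb N_0$ and $M\in\mathbb N$, let $\mathcal A_{n,M}=\{a\in\mathbb Z:\gcd(a,M)=1,\ \mathrm{ord}(a/M)=n\}$; this set is a union of congruence classes modulo $M^{n+1}$, and $A(n,M)$ denotes the number of congruence classes modulo $M^{n+1}$ contained in $\mathcal A_{n,M}$ (so $A(0,1)=1$, $A(n,1)=0$ for $n\ge1$, $A(0,M)=0$ for $M>1$). $\varphi$ is Euler's totient function. -}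

module Defs where

open import Data.Nat as ℕ using (ℕ; zero; suc; _∸_; _^_; NonZero)
open import Data.Nat.Properties as ℕP using ()
open import Data.Nat.Coprimality using (Coprime; coprime?)
open import Data.Nat.Divisibility using (_∣?_)
open import Data.Nat.DivMod using (_/_)
open import Data.Integer as ℤ using (ℤ; +_)
open import Data.Rational as ℚ using (ℚ; ceiling)
open import Data.Fin using (Fin; toℕ)
open import Data.Fin.Properties using (all?)
open import Data.List using (List; length; filter; upTo; map)
open import Data.Nat.ListAction using (sum)
open import Data.Product using (_×_)
open import Relation.Nullary using (¬_; ¬?)
open import Relation.Nullary.Decidable using (_×-dec_)
open import Relation.Binary.PropositionalEquality using (_≡_)
open import Function using (_∘_)

χ : ℚ → ℚ
χ x = x ℚ.* (ceiling x ℚ./ 1)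

χ^ : ℕ → ℚ → ℚ
χ^ zero    x = x
χ^ (suc k) x = χ (χ^ k x)

IsInt : ℚ → Set
IsInt q = ℚ.denominatorℕ q ≡ 1

isInt? : (q : ℚ) → Relation.Nullary.Dec (IsInt q)
isInt? q = ℚ.denominatorℕ q ℕ.≟ 1

OrdIs : ℚ → ℕ → Set
OrdIs x n = IsInt (χ^ n x) × (∀ (k : Fin n) → ¬ IsInt (χ^ (toℕ k) x))

ordIs? : (x : ℚ) (n : ℕ) → Relation.Nullary.Dec (OrdIs x n)
ordIs? x n = isInt? (χ^ n x) ×-dec all? (λ k → ¬? (isInt? (χ^ (toℕ k) x)))

InA : (n M : ℕ) → .{{_ : NonZero M}} → ℕ → Set
InA n M a = Coprime a M × OrdIs ((+ a) ℚ./ M) n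

inA? : (n M : ℕ) → .{{_ : NonZero M}} → (a : ℕ) → Relation.Nullary.Dec (InA n M a)
inA? n M a = coprime? a M ×-dec ordIs? ((+ a) ℚ./ M) n

-- A(n,M): number of residues a ∈ {0,…,M^(n+1)-1} (one representative per
-- congruence class mod M^(n+1)) lying in 𝒜_{n,M}
A : (n M : ℕ) → .{{_ : NonZero M}} → ℕ
A n M = length (filter (inA? n M) (upTo (M ^ suc n)))

φ : ℕ → ℕ
φ M = length (filter (λ k → coprime? k M) (map suc (upTo M)))

divisorSum : (n M : ℕ) → ℕ
divisorSum n M =
  sum (map (λ k → A (n ∸ 1) (suc k) ℕ.* ((M / suc k) ^ (n ∸ 1)))
           (filter (λ k → suc k ∣? M) (upTo M)))

-- Write a = q M + s with s < M.  When M > 1 and gcd(s, M) = 1, a/M is not an integer and its ceiling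
-- is q + 1, so ord(a/M) = 1 + ord ξ with ξ = (q M + s)(q + 1)/M.  Let d = M / gcd(q + 1, M) and
-- g = M / d; then q = i g + (g - 1) with i + 1 coprime to d, and ξ = w i / d where
-- w i = (q M + s)(i + 1) is again coprime to d.  Two facts about a fixed d finish the count:
-- whether ord(b/d) = m depends only on b mod d^(m+1), because b ↦ b ⌈b/d⌉ sends b + t d^(j+1) to
-- the image of b plus a multiple of d^j; and i ↦ w i mod d^(m+1) permutes the residues mod d^(m+1),
-- because w (i + e) - w i = e u with u ≡ s (mod d) a unit.  Hence among q < M^(m+1) exactly
-- A(m, d) (M/d)^m lie in the class of d and have ord ξ = m; summing over the divisors d of M and
-- the φ(M) residues s gives the recursion.
module Submission where

open import Defs
open import Data.Nat using (ℕ; _*_; _≤_; _<_; NonZero)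
open import Data.Sum using (_⊎_)
open import Relation.Binary.PropositionalEquality using (_≡_)

open import Data.Nat.Base
  using (zero; suc; _+_; _∸_; _^_; >-nonZero; ≢-nonZero; ≢-nonZero⁻¹; z≤n; s≤s; z<s; s<s; s≤s⁻¹)
open import Data.Nat.Properties
open import Algebra.Properties.CommutativeSemigroup +-commutativeSemigroup
  using (xy∙z≈xz∙y) renaming (interchange to +-interchange)
open import Algebra.Properties.CommutativeSemigroup *-commutativeSemigroup
  using () renaming (interchange to *-interchange)
open import Data.Nat.Coprimality as Coprime using (Coprime; coprime?)
open import Data.Nat.DivMod
  using (_%_; _/_; m≡m%n+[m/n]*n; m%n<n; m/n*n≡m; m*n/n≡m; [m+kn]%n≡m%n)
open import Data.Nat.Divisibility
  using ( _∣_; _∣?_; divides; 1∣_; ∣⇒≤; ∣-refl; ∣-trans; ∣-antisym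
        ; ∣m+n∣m⇒∣n; ∣m∣n⇒∣m+n; ∣n⇒∣m*n; m∣m*n; n∣m*n)
open import Data.Nat.GCD
  using (gcd; gcd-greatest; gcd[m,n]∣m; gcd[m,n]∣n; gcd[m,n]≢0; n/gcd[m,n]≢0; c*gcd[m,n]≡gcd[cm,cn])
open import Data.Nat.ListAction using (sum)
open import Data.Nat.Tactic.RingSolver using (solve-∀)
open import Data.Integer as ℤ using (-[1+_])
import Data.Integer.Properties as ℤ
open import Data.Rational as ℚ using (ℚ; mkℚ; ↥_; ↧ₙ_; ceiling)
import Data.Rational.Properties as ℚ
import Data.Rational.Unnormalised as ℚᵘ
import Data.Rational.Unnormalised.Properties as ℚᵘ
open import Data.Fin as Fin using (toℕ)
import Data.Fin.Properties as Fin
open import Data.List using (length; filter; map; applyUpTo)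
open import Data.List.Properties using (map-applyUpTo)
open import Data.Product using (Σ-syntax; _×_; _,_; proj₁; proj₂)
open import Data.Product.Function.NonDependent.Propositional using (_×-⇔_)
open import Data.Sum using (inj₁; inj₂)
open import Function using (id; _∘_; _∘₂_; _⟨_⟩_; _⇔_; mk⇔; Equivalence)
import Function.Properties.Equivalence as ⇔
open import Level using (Level)
open import Relation.Nullary using (¬_; Dec; yes; no; contradiction)
open import Relation.Nullary.Decidable using (_×-dec_; ¬?)
open import Relation.Unary using (Pred; Decidable)
open import Relation.Binary.Definitions using (tri<; tri≈; tri>)
open import Relation.Binary.PropositionalEquality
  using (_≢_; refl; sym; trans; cong; cong₂; subst; subst₂; module ≡-Reasoning)

private variable
  ℓ ℓ′ : Level
  X : Set ℓ
  Y : Set ℓ′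
  P : Pred ℕ ℓ
  Q : Pred ℕ ℓ′

-- Sums and counts over initial segments of ℕ

∑< : ℕ → (ℕ → ℕ) → ℕ
∑< zero    f = 0
∑< (suc n) f = f 0 + ∑< n (f ∘ suc)

infix 5 ∑<
syntax ∑< n (λ i → e) = ∑[ i < n ] e

∑-cong : ∀ n {f g : ℕ → ℕ} → (∀ i → i < n → f i ≡ g i) → ∑< n f ≡ ∑< n g
∑-cong zero    eq = refl
∑-cong (suc n) eq = cong₂ _+_ (eq 0 z<s) (∑-cong n (λ i i<n → eq (suc i) (s<s i<n)))

∑-zero : ∀ n {f : ℕ → ℕ} → (∀ i → i < n → f i ≡ 0) → ∑< n f ≡ 0
∑-zero zero    eq = refl
∑-zero (suc n) eq = cong₂ _+_ (eq 0 z<s) (∑-zero n (λ i i<n → eq (suc i) (s<s i<n)))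

∑-++ : ∀ m n (f : ℕ → ℕ) → ∑< (m + n) f ≡ ∑< m f + (∑[ i < n ] f (m + i))
∑-++ zero    n f = refl
∑-++ (suc m) n f = trans (cong (f 0 +_) (∑-++ m n (f ∘ suc))) (sym (+-assoc (f 0) _ _))

∑-distrib-+ : ∀ n (f g : ℕ → ℕ) → ∑[ i < n ] (f i + g i) ≡ ∑< n f + ∑< n g
∑-distrib-+ zero    f g = refl
∑-distrib-+ (suc n) f g =
  trans (cong (f 0 + g 0 +_) (∑-distrib-+ n (f ∘ suc) (g ∘ suc))) (+-interchange (f 0) (g 0) _ _)

∑-distribʳ-* : ∀ n c (f : ℕ → ℕ) → ∑[ i < n ] (f i * c) ≡ ∑< n f * c
∑-distribʳ-* zero    c f = refl
∑-distribʳ-* (suc n) c f =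
  trans (cong (f 0 * c +_) (∑-distribʳ-* n c (f ∘ suc))) (sym (*-distribʳ-+ c (f 0) _))

∑-blocks : ∀ n m (f : ℕ → ℕ) → ∑< (n * m) f ≡ ∑[ q < n ] ∑[ r < m ] f (q * m + r)
∑-blocks zero    m f = refl
∑-blocks (suc n) m f = begin
  ∑< (m + n * m) f                                      ≡⟨ ∑-++ m (n * m) f ⟩
  ∑< m f + (∑[ i < n * m ] f (m + i))                   ≡⟨ cong (∑< m f +_) (∑-blocks n m (λ i → f (m + i))) ⟩
  ∑< m f + (∑[ q < n ] ∑[ r < m ] f (m + (q * m + r)))  ≡⟨ cong (∑< m f +_) (∑-cong n λ q _ → ∑-cong m λ r _ →
                                                             cong f (sym (+-assoc m (q * m) r))) ⟩
  ∑< m f + (∑[ q < n ] ∑[ r < m ] f (m + q * m + r))    ∎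
  where open ≡-Reasoning

∑-swap : ∀ n m (f : ℕ → ℕ → ℕ) → ∑[ i < n ] ∑[ j < m ] f i j ≡ ∑[ j < m ] ∑[ i < n ] f i j
∑-swap zero    m f = sym (∑-zero m (λ _ _ → refl))
∑-swap (suc n) m f = trans (cong (∑< m (f 0) +_) (∑-swap n m (f ∘ suc)))
                           (sym (∑-distrib-+ m (f 0) (λ j → ∑[ i < n ] f (suc i) j)))

∑-periodic : ∀ K p (f : ℕ → ℕ) → (∀ i → f (p + i) ≡ f i) → ∑< (K * p) f ≡ K * ∑< p f
∑-periodic zero    p f per = refl
∑-periodic (suc K) p f per = begin
  ∑< (p + K * p) f                     ≡⟨ ∑-++ p (K * p) f ⟩
  ∑< p f + (∑[ i < K * p ] f (p + i))  ≡⟨ cong (∑< p f +_) (∑-cong (K * p) (λ i _ → per i)) ⟩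
  ∑< p f + ∑< (K * p) f                ≡⟨ cong (∑< p f +_) (∑-periodic K p f per) ⟩
  ∑< p f + K * ∑< p f                  ∎
  where open ≡-Reasoning

∑-single : ∀ n k (f : ℕ → ℕ) → k < n → (∀ i → i < n → i ≢ k → f i ≡ 0) → ∑< n f ≡ f k
∑-single (suc n) zero    f _ zeros =
  trans (cong (f 0 +_) (∑-zero n (λ i i<n → zeros (suc i) (s<s i<n) (λ ())))) (+-identityʳ (f 0))
∑-single (suc n) (suc k) f (s<s k<n) zeros =
  trans (cong (_+ ∑< n (f ∘ suc)) (zeros 0 z<s (λ ())))
        (∑-single n k (f ∘ suc) k<n (λ i i<n i≢k → zeros (suc i) (s<s i<n) (i≢k ∘ suc-injective)))

∑-snoc : ∀ n (f : ℕ → ℕ) → ∑< (suc n) f ≡ ∑< n f + f n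
∑-snoc zero    f = +-comm (f 0) 0
∑-snoc (suc n) f = trans (cong (f 0 +_) (∑-snoc n (f ∘ suc))) (sym (+-assoc (f 0) _ _))

∑-rotate : ∀ n (f : ℕ → ℕ) → f n ≡ f 0 → ∑[ i < n ] f (suc i) ≡ ∑< n f
∑-rotate zero    f _  = refl
∑-rotate (suc n) f eq = begin
  ∑[ i < suc n ] f (suc i)            ≡⟨ ∑-snoc n (f ∘ suc) ⟩
  (∑[ i < n ] f (suc i)) + f (suc n)  ≡⟨ cong ((∑[ i < n ] f (suc i)) +_) eq ⟩
  (∑[ i < n ] f (suc i)) + f 0        ≡⟨ +-comm _ (f 0) ⟩
  ∑< (suc n) f                        ∎
  where open ≡-Reasoning

𝟙 : Dec X → ℕ
𝟙 (yes _) = 1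
𝟙 (no _)  = 0

𝟙-yes : (X? : Dec X) → X → 𝟙 X? ≡ 1
𝟙-yes (yes _) _ = refl
𝟙-yes (no ¬x) x = contradiction x ¬x

𝟙-no : (X? : Dec X) → ¬ X → 𝟙 X? ≡ 0
𝟙-no (yes x) ¬x = contradiction x ¬x
𝟙-no (no _)  _  = refl

𝟙-cong : (X? : Dec X) (Y? : Dec Y) → X ⇔ Y → 𝟙 X? ≡ 𝟙 Y?
𝟙-cong (yes _) (yes _) _   = refl
𝟙-cong (yes x) (no ¬y) X⇔Y = contradiction (Equivalence.to X⇔Y x) ¬y
𝟙-cong (no ¬x) (yes y) X⇔Y = contradiction (Equivalence.from X⇔Y y) ¬x
𝟙-cong (no _)  (no _)  _   = refl

𝟙-split : (X? : Dec X) (Y? : Dec Y) → 𝟙 X? ≡ 𝟙 (X? ×-dec Y?) + 𝟙 (X? ×-dec ¬? Y?)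
𝟙-split (yes _) (yes _) = refl
𝟙-split (yes _) (no _)  = refl
𝟙-split (no _)  _       = refl

𝟙-+-𝟙-¬ : (X? : Dec X) → 𝟙 X? + 𝟙 (¬? X?) ≡ 1
𝟙-+-𝟙-¬ (yes _) = refl
𝟙-+-𝟙-¬ (no _)  = refl

proj₂-⇔ : X → (X × Y) ⇔ Y
proj₂-⇔ x = mk⇔ proj₂ (x ,_)

count : Decidable P → ℕ → ℕ
count P? n = ∑[ i < n ] 𝟙 (P? i)

length-filter-applyUpTo : ∀ (P? : Decidable P) f n →
  length (filter P? (applyUpTo f n)) ≡ ∑[ i < n ] 𝟙 (P? (f i))
length-filter-applyUpTo P? f zero = refl
length-filter-applyUpTo P? f (suc n) with P? (f 0)
... | yes _ = cong suc (length-filter-applyUpTo P? (f ∘ suc) n)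
... | no _  = length-filter-applyUpTo P? (f ∘ suc) n

sum-map-filter-applyUpTo : ∀ (P? : Decidable P) (g f : ℕ → ℕ) n →
  sum (map g (filter P? (applyUpTo f n))) ≡ ∑[ i < n ] 𝟙 (P? (f i)) * g (f i)
sum-map-filter-applyUpTo P? g f zero = refl
sum-map-filter-applyUpTo P? g f (suc n) with P? (f 0)
... | yes _ = cong₂ _+_ (sym (*-identityˡ (g (f 0)))) (sum-map-filter-applyUpTo P? g (f ∘ suc) n)
... | no _  = sum-map-filter-applyUpTo P? g (f ∘ suc) n

count-+-count-¬ : ∀ (P? : Decidable P) n → count P? n + count (¬? ∘ P?) n ≡ n
count-+-count-¬ P? zero    = refl
count-+-count-¬ P? (suc n) = begin
  𝟙 (P? 0) + count (P? ∘ suc) n + (𝟙 (¬? (P? 0)) + count (¬? ∘ P? ∘ suc) n)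
    ≡⟨ +-interchange (𝟙 (P? 0)) _ _ _ ⟩
  𝟙 (P? 0) + 𝟙 (¬? (P? 0)) + (count (P? ∘ suc) n + count (¬? ∘ P? ∘ suc) n)
    ≡⟨ cong₂ _+_ (𝟙-+-𝟙-¬ (P? 0)) (count-+-count-¬ (P? ∘ suc) n) ⟩
  suc n
    ∎
  where open ≡-Reasoning

count-remove : ∀ (P? : Decidable P) {x m} → x < m → P x →
  count P? m ≡ suc (count (λ i → P? i ×-dec ¬? (i ≟ x)) m)
count-remove {P = P} P? {x} {m} x<m Px = begin
  count P? m                                                  ≡⟨ ∑-cong m (λ i _ → 𝟙-split (P? i) (¬? (i ≟ x))) ⟩
  ∑[ i < m ] (𝟙 (P≢x? i) + 𝟙 (P? i ×-dec ¬? (¬? (i ≟ x))))    ≡⟨ ∑-distrib-+ m _ _ ⟩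
  count P≢x? m + (∑[ i < m ] 𝟙 (P? i ×-dec ¬? (¬? (i ≟ x))))  ≡⟨ cong (count P≢x? m +_) only-x ⟩
  count P≢x? m + 1                                            ≡⟨ +-comm _ 1 ⟩
  suc (count P≢x? m)                                          ∎
  where
  open ≡-Reasoning
  P≢x? : Decidable (λ i → P i × i ≢ x)
  P≢x? i = P? i ×-dec ¬? (i ≟ x)
  only-x : ∑[ i < m ] 𝟙 (P? i ×-dec ¬? (¬? (i ≟ x))) ≡ 1
  only-x = trans (∑-single m x _ x<m (λ i _ i≢x → 𝟙-no (P? i ×-dec _) (λ (_ , ¬i≢x) → ¬i≢x i≢x)))
                 (𝟙-yes (P? x ×-dec _) (Px , λ x≢x → x≢x refl))

count-≤-injection : ∀ (P? : Decidable P) (Q? : Decidable Q) (f : ℕ → ℕ) n m →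
  (∀ i → i < n → P i → f i < m × Q (f i)) →
  (∀ i j → i < n → j < n → P i → P j → f i ≡ f j → i ≡ j) →
  count P? n ≤ count Q? m
count-≤-injection P? Q? f zero    m maps inj = z≤n
count-≤-injection {P = P} {Q = Q} P? Q? f (suc n) m maps inj with P? 0
... | no _   = count-≤-injection (P? ∘ suc) Q? (f ∘ suc) n m (λ i i<n → maps (suc i) (s<s i<n))
                 (λ i j i<n j<n Pi Pj → suc-injective ∘ inj (suc i) (suc j) (s<s i<n) (s<s j<n) Pi Pj)
... | yes P0 = begin
  suc (count (P? ∘ suc) n)  ≤⟨ s≤s (count-≤-injection (P? ∘ suc) Q≢f0? (f ∘ suc) n m maps′ inj′) ⟩
  suc (count Q≢f0? m)       ≡⟨ count-remove Q? (proj₁ (maps 0 z<s P0)) (proj₂ (maps 0 z<s P0)) ⟨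
  count Q? m                ∎
  where
  open ≤-Reasoning
  Q≢f0? : Decidable (λ j → Q j × j ≢ f 0)
  Q≢f0? j = Q? j ×-dec ¬? (j ≟ f 0)
  inj′ : ∀ i j → i < n → j < n → P (suc i) → P (suc j) → f (suc i) ≡ f (suc j) → i ≡ j
  inj′ i j i<n j<n Pi Pj = suc-injective ∘ inj (suc i) (suc j) (s<s i<n) (s<s j<n) Pi Pj
  maps′ : ∀ i → i < n → P (suc i) → f (suc i) < m × (Q (f (suc i)) × f (suc i) ≢ f 0)
  maps′ i i<n Pi = proj₁ (maps (suc i) (s<s i<n) Pi) , proj₂ (maps (suc i) (s<s i<n) Pi) ,
                   λ eq → 1+n≢0 (inj (suc i) 0 (s<s i<n) z<s Pi P0 eq)

m≤n⇒o≤p⇒m+o≡n+p⇒m≡n : ∀ {m n o p} → m ≤ n → o ≤ p → m + o ≡ n + p → m ≡ n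
m≤n⇒o≤p⇒m+o≡n+p⇒m≡n {m} {n} {o} {p} m≤n o≤p eq =
  ≤-antisym m≤n (+-cancelʳ-≤ p n m (subst (_≤ m + p) eq (+-monoʳ-≤ m o≤p)))

count-∘-permutation : ∀ (P? : Decidable P) (f : ℕ → ℕ) n →
  (∀ i → i < n → f i < n) → (∀ i j → i < n → j < n → f i ≡ f j → i ≡ j) →
  count (P? ∘ f) n ≡ count P? n
count-∘-permutation P? f n into inj = m≤n⇒o≤p⇒m+o≡n+p⇒m≡n
  (count-≤-injection (P? ∘ f) P? f n n (λ i i<n Pfi → into i i<n , Pfi) (λ i j i<n j<n _ _ → inj i j i<n j<n))
  (count-≤-injection (¬? ∘ P? ∘ f) (¬? ∘ P?) f n n (λ i i<n ¬Pfi → into i i<n , ¬Pfi)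
                     (λ i j i<n j<n _ _ → inj i j i<n j<n))
  (trans (count-+-count-¬ (P? ∘ f) n) (sym (count-+-count-¬ P? n)))

-- Coprimality and divisibility

coprime-∣ʳ : ∀ {m n d} → d ∣ n → Coprime m n → Coprime m d
coprime-∣ʳ d∣n m⊥n (e∣m , e∣d) = m⊥n (e∣m , ∣-trans e∣d d∣n)

coprime-*ˡ : ∀ {m n d} → Coprime m d → Coprime n d → Coprime (m * n) d
coprime-*ˡ {m} {n} {d} m⊥d n⊥d {e} (e∣mn , e∣d) = n⊥d (Coprime.coprime-divisor e⊥m e∣mn , e∣d)
  where
  e⊥m : Coprime e m
  e⊥m (f∣e , f∣m) = m⊥d (f∣m , ∣-trans f∣e e∣d)

coprime-*-factorʳ : ∀ {m n d} → Coprime (m * n) d → Coprime n d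
coprime-*-factorʳ {m} mn⊥d (e∣n , e∣d) = mn⊥d (∣n⇒∣m*n m e∣n , e∣d)

coprime-^ʳ : ∀ {m d} k → Coprime m d → Coprime m (d ^ k)
coprime-^ʳ {m} zero    m⊥d = Coprime.sym (Coprime.1-coprimeTo m)
coprime-^ʳ     (suc k) m⊥d = Coprime.sym (coprime-*ˡ (Coprime.sym m⊥d) (Coprime.sym (coprime-^ʳ k m⊥d)))

coprime-+-∣ : ∀ {m k d} → d ∣ k → Coprime m d → Coprime (m + k) d
coprime-+-∣ {m} {k} d∣k m⊥d {e} (e∣m+k , e∣d) =
  m⊥d (∣m+n∣m⇒∣n (subst (e ∣_) (+-comm m k) e∣m+k) (∣-trans e∣d d∣k) , e∣d)

coprime-+-∣⁻¹ : ∀ {m k d} → d ∣ k → Coprime (m + k) d → Coprime m d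
coprime-+-∣⁻¹ d∣k m+k⊥d (e∣m , e∣d) = m+k⊥d (∣m∣n⇒∣m+n e∣m (∣-trans e∣d d∣k) , e∣d)

coprime-%⇔ : ∀ {m d} n .{{_ : NonZero n}} → d ∣ n → Coprime (m % n) d ⇔ Coprime m d
coprime-%⇔ {m} {d} n d∣n = mk⇔ to from
  where
  m≡ : m ≡ m % n + (m / n) * n
  m≡ = m≡m%n+[m/n]*n m n
  d∣qn : d ∣ (m / n) * n
  d∣qn = ∣n⇒∣m*n (m / n) d∣n
  to : Coprime (m % n) d → Coprime m d
  to r⊥d = subst (λ x → Coprime x d) (sym m≡) (coprime-+-∣ d∣qn r⊥d)
  from : Coprime m d → Coprime (m % n) d
  from m⊥d = coprime-+-∣⁻¹ d∣qn (subst (λ x → Coprime x d) m≡ m⊥d)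

gcd[m*g,n*g]≡g⇔coprime : ∀ m n g .{{_ : NonZero g}} → gcd (m * g) (n * g) ≡ g ⇔ Coprime m n
gcd[m*g,n*g]≡g⇔coprime m n g = mk⇔ to from
  where
  g*gcd : g * gcd m n ≡ gcd (m * g) (n * g)
  g*gcd = trans (c*gcd[m,n]≡gcd[cm,cn] g m n) (cong₂ gcd (*-comm g m) (*-comm g n))
  to : gcd (m * g) (n * g) ≡ g → Coprime m n
  to eq = Coprime.gcd≡1⇒coprime (*-cancelˡ-≡ (gcd m n) 1 g (trans g*gcd (trans eq (sym (*-identityʳ g)))))
  from : Coprime m n → gcd (m * g) (n * g) ≡ g
  from m⊥n = trans (sym g*gcd) (trans (cong (g *_) (Coprime.coprime⇒gcd≡1 m⊥n)) (*-identityʳ g))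

∣-+-∣⇔ : ∀ {d m n} → d ∣ n → d ∣ m + n ⇔ d ∣ m
∣-+-∣⇔ {d} {m} {n} d∣n =
  mk⇔ (λ d∣m+n → ∣m+n∣m⇒∣n (subst (d ∣_) (+-comm m n) d∣m+n) d∣n) (λ d∣m → ∣m∣n⇒∣m+n d∣m d∣n)

[m+n]%o≡m%o⇒o∣n : ∀ m n o .{{_ : NonZero o}} → (m + n) % o ≡ m % o → o ∣ n
[m+n]%o≡m%o⇒o∣n m n o eq = divides ((m + n) / o ∸ m / o) (begin
  n                                              ≡⟨ m+n∸m≡n m n ⟨
  m + n ∸ m                                      ≡⟨ cong₂ _∸_ m+n≡ (m≡m%n+[m/n]*n m o) ⟩
  m % o + (m + n) / o * o ∸ (m % o + m / o * o)  ≡⟨ [m+n]∸[m+o]≡n∸o (m % o) _ _ ⟩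
  (m + n) / o * o ∸ m / o * o                    ≡⟨ *-distribʳ-∸ o ((m + n) / o) (m / o) ⟨
  ((m + n) / o ∸ m / o) * o                      ∎)
  where
  open ≡-Reasoning
  m+n≡ : m + n ≡ m % o + (m + n) / o * o
  m+n≡ = trans (m≡m%n+[m/n]*n (m + n) o) (cong (_+ (m + n) / o * o) eq)

^-distrib-* : ∀ m n k → (m * n) ^ k ≡ m ^ k * n ^ k
^-distrib-* m n zero    = refl
^-distrib-* m n (suc k) = trans (cong (m * n *_) (^-distrib-* m n k)) (*-interchange m n (m ^ k) (n ^ k))

-- Ceilings of fractions and iterates of χ

_/ℚ_ : ℕ → (M : ℕ) → .{{NonZero M}} → ℚ
a /ℚ M = (ℤ.+ a) ℚ./ M

/ℚ-cross : ∀ a b M N .{{_ : NonZero M}} .{{_ : NonZero N}} → a * N ≡ b * M → a /ℚ M ≡ b /ℚ N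
/ℚ-cross a b (suc m) (suc n) eq =
  ℚ.fromℚᵘ-cong {ℚᵘ.mkℚᵘ (ℤ.+ a) m} {ℚᵘ.mkℚᵘ (ℤ.+ b) n} (ℚᵘ.*≡* (begin
    ℤ.+ a ℤ.* ℤ.+ suc n  ≡⟨ ℤ.pos-* a (suc n) ⟨
    ℤ.+ (a * suc n)      ≡⟨ cong ℤ.+_ eq ⟩
    ℤ.+ (b * suc m)      ≡⟨ ℤ.pos-* b (suc m) ⟩
    ℤ.+ b ℤ.* ℤ.+ suc m  ∎))
  where open ≡-Reasoning

IsCeil : ℕ → ℕ → ℕ → Set
IsCeil a M c = a ≤ c * M × c * M < a + M

isCeil-unique : ∀ {a M c c′} → IsCeil a M c → IsCeil a M c′ → c ≡ c′
isCeil-unique {a} {M} (a≤cM , cM<a+M) (a≤c′M , c′M<a+M) =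
  ≤-antisym (below a≤c′M cM<a+M) (below a≤cM c′M<a+M)
  where
  below : ∀ {x y} → a ≤ x * M → y * M < a + M → y ≤ x
  below {x} {y} a≤xM yM<a+M = s≤s⁻¹ (*-cancelʳ-< M y (suc x) (<-≤-trans yM<a+M (begin
    a + M      ≤⟨ +-monoˡ-≤ M a≤xM ⟩
    x * M + M  ≡⟨ +-comm (x * M) M ⟩
    suc x * M  ∎)))
    where open ≤-Reasoning

isCeil-*ʳ : ∀ {a M c} g .{{_ : NonZero g}} → IsCeil a M c → IsCeil (a * g) (M * g) c
isCeil-*ʳ {a} {M} {c} g (a≤cM , cM<a+M) =
  subst (a * g ≤_) (*-assoc c M g) (*-monoˡ-≤ g a≤cM) ,
  subst₂ _<_ (*-assoc c M g) (*-distribʳ-+ g a M) (*-monoˡ-< g cM<a+M)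

isCeil-+ : ∀ {a M c} t → IsCeil a M c → IsCeil (a + t * M) M (c + t)
isCeil-+ {a} {M} {c} t (a≤cM , cM<a+M) =
  subst (a + t * M ≤_) (sym (*-distribʳ-+ M c t)) (+-monoˡ-≤ (t * M) a≤cM) ,
  subst₂ _<_ (sym (*-distribʳ-+ M c t)) (xy∙z≈xz∙y a M (t * M)) (+-monoˡ-< (t * M) cM<a+M)

isCeil-suc : ∀ q {s M} → 0 < s → s ≤ M → IsCeil (q * M + s) M (suc q)
isCeil-suc q {s} {M} 0<s s≤M =
  subst (q * M + s ≤_) (+-comm (q * M) M) (+-monoʳ-≤ (q * M) s≤M) ,
  subst (_< q * M + s + M) (+-comm (q * M) M) (+-monoˡ-< M (m<m+n (q * M) 0<s))

-- ceiling p is - floor (- p), and the floor of the negative numerator -[1+ u ] splits on (1 + u) % (1 + d).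
ceiling-mkℚ : ∀ u d .(u⊥d : Coprime u (suc d)) →
  Σ[ c ∈ ℕ ] ceiling (mkℚ (ℤ.+ u) d u⊥d) ≡ ℤ.+ c × IsCeil u (suc d) c
ceiling-mkℚ zero    d _ = 0 , refl , z≤n , z<s
ceiling-mkℚ (suc u) d _ with suc u % suc d in r≡
... | zero  = q , trans (cong ℤ.-_ (ℤ.*-identityˡ _)) (ℤ.neg-involutive _) ,
              ≤-reflexive u≡qd , subst (_< suc u + suc d) u≡qd (m<m+n (suc u) z<s)
  where
  q : ℕ
  q = suc u / suc d
  u≡qd : suc u ≡ q * suc d
  u≡qd = trans (m≡m%n+[m/n]*n (suc u) (suc d)) (cong (_+ q * suc d) r≡)
... | suc r = suc q , cong ℤ.-_ (ℤ.*-identityˡ -[1+ q ]) , u≤ , <u+d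
  where
  q : ℕ
  q = suc u / suc d
  u≡ : suc u ≡ suc r + q * suc d
  u≡ = trans (m≡m%n+[m/n]*n (suc u) (suc d)) (cong (_+ q * suc d) r≡)
  r<d : suc r < suc d
  r<d = subst (_< suc d) r≡ (m%n<n (suc u) (suc d))
  u≤ : suc u ≤ suc d + q * suc d
  u≤ = subst (_≤ suc d + q * suc d) (sym u≡) (+-monoˡ-≤ (q * suc d) (<⇒≤ r<d))
  <u+d : suc d + q * suc d < suc u + suc d
  <u+d = subst (_< suc u + suc d) (+-comm (q * suc d) (suc d))
           (+-monoˡ-< (suc d) (subst (q * suc d <_) (sym u≡) (m<n+m (q * suc d) z<s)))

ceiling-nonNeg : ∀ p {u} → ↥ p ≡ ℤ.+ u → Σ[ c ∈ ℕ ] ceiling p ≡ ℤ.+ c × IsCeil u (↧ₙ p) c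
ceiling-nonNeg (mkℚ _ d u⊥d) refl = ceiling-mkℚ _ d u⊥d

ceiling-/ℚ : ∀ a M .{{_ : NonZero M}} → Σ[ c ∈ ℕ ] ceiling (a /ℚ M) ≡ ℤ.+ c × IsCeil a M c
ceiling-/ℚ a M =
  let c , ceil≡c , isCeil = ceiling-nonNeg (a /ℚ M) (ℚ.↥-mkℚ+ (a / g) (M / g)) in
  c , ceil≡c ,
  subst₂ (λ x y → IsCeil x y c) (m/n*n≡m (gcd[m,n]∣m a M)) (m/n*n≡m (gcd[m,n]∣n a M))
    (isCeil-*ʳ {a / g} {M / g} {c} g (subst (λ y → IsCeil (a / g) y c) ↧≡ isCeil))
  where
  g : ℕ
  g = gcd a M
  instance
    g≢0 : NonZero g
    g≢0 = ≢-nonZero (gcd[m,n]≢0 a M (inj₂ (≢-nonZero⁻¹ M)))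
    M/g≢0 : NonZero (M / g)
    M/g≢0 = ≢-nonZero (n/gcd[m,n]≢0 a M)
  ↧≡ : ↧ₙ (a /ℚ M) ≡ M / g
  ↧≡ = ℤ.+-injective (ℚ.↧-mkℚ+ (a / g) (M / g))

ceilDiv : ℕ → (M : ℕ) → .{{NonZero M}} → ℕ
ceilDiv a M = proj₁ (ceiling-/ℚ a M)

ceiling-/ℚ≡ceilDiv : ∀ a M .{{_ : NonZero M}} → ceiling (a /ℚ M) ≡ ℤ.+ ceilDiv a M
ceiling-/ℚ≡ceilDiv a M = proj₁ (proj₂ (ceiling-/ℚ a M))

isCeil-ceilDiv : ∀ a M .{{_ : NonZero M}} → IsCeil a M (ceilDiv a M)
isCeil-ceilDiv a M = proj₂ (proj₂ (ceiling-/ℚ a M))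

ceilDiv-unique : ∀ {a M c} .{{_ : NonZero M}} → IsCeil a M c → ceilDiv a M ≡ c
ceilDiv-unique {a} {M} = isCeil-unique (isCeil-ceilDiv a M)

χ-/ℚ : ∀ a M .{{_ : NonZero M}} → χ (a /ℚ M) ≡ (a * ceilDiv a M) /ℚ M
χ-/ℚ a M@(suc m) = begin
  χ (a /ℚ M)                             ≡⟨ cong (λ z → a /ℚ M ℚ.* (z ℚ./ 1)) (ceiling-/ℚ≡ceilDiv a M) ⟩
  a /ℚ M ℚ.* c /ℚ 1                      ≡⟨ ℚ.fromℚᵘ-toℚᵘ (a /ℚ M ℚ.* c /ℚ 1) ⟨
  ℚ.fromℚᵘ (ℚ.toℚᵘ (a /ℚ M ℚ.* c /ℚ 1))  ≡⟨ ℚ.fromℚᵘ-cong product ⟩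
  (a * c) /ℚ M                           ∎
  where
  open ≡-Reasoning
  c : ℕ
  c = ceilDiv a M
  product : ℚ.toℚᵘ (a /ℚ M ℚ.* c /ℚ 1) ℚᵘ.≃ ℚᵘ.mkℚᵘ (ℤ.+ (a * c)) m
  product = ℚᵘ.≃-trans (ℚ.toℚᵘ-homo-* (a /ℚ M) (c /ℚ 1))
    (ℚᵘ.≃-trans (ℚᵘ.*-cong (ℚ.toℚᵘ-fromℚᵘ (ℚᵘ.mkℚᵘ (ℤ.+ a) m)) (ℚ.toℚᵘ-fromℚᵘ (ℚᵘ.mkℚᵘ (ℤ.+ c) 0)))
      (ℚᵘ.*≡* (cong₂ ℤ._*_ (sym (ℤ.pos-* a c)) (cong ℤ.+_ (sym (*-identityʳ M))))))

↧ₙ-/ℚ*gcd : ∀ a M .{{_ : NonZero M}} → ↧ₙ (a /ℚ M) * gcd a M ≡ M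
↧ₙ-/ℚ*gcd a M = ℤ.+-injective (trans (ℤ.pos-* (↧ₙ (a /ℚ M)) (gcd a M)) (ℚ.↧-/ (ℤ.+ a) M))

isInt-/ℚ⇔∣ : ∀ a M .{{_ : NonZero M}} → IsInt (a /ℚ M) ⇔ M ∣ a
isInt-/ℚ⇔∣ a M = mk⇔ to from
  where
  to : IsInt (a /ℚ M) → M ∣ a
  to ↧≡1 = subst (_∣ a) (trans (sym (*-identityˡ _)) (trans (cong (_* gcd a M) (sym ↧≡1)) (↧ₙ-/ℚ*gcd a M)))
                 (gcd[m,n]∣m a M)
  from : M ∣ a → IsInt (a /ℚ M)
  from M∣a = *-cancelʳ-≡ _ 1 M
    (trans (cong (↧ₙ (a /ℚ M) *_) (sym gcd≡M)) (trans (↧ₙ-/ℚ*gcd a M) (sym (*-identityˡ M))))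
    where
    gcd≡M : gcd a M ≡ M
    gcd≡M = ∣-antisym (gcd[m,n]∣n a M) (gcd-greatest M∣a ∣-refl)

χₙ : (M : ℕ) → .{{NonZero M}} → ℕ → ℕ
χₙ M a = a * ceilDiv a M

χₙ^ : (M : ℕ) → .{{NonZero M}} → ℕ → ℕ → ℕ
χₙ^ M zero    a = a
χₙ^ M (suc k) a = χₙ M (χₙ^ M k a)

χ^-/ℚ : ∀ k a M .{{_ : NonZero M}} → χ^ k (a /ℚ M) ≡ χₙ^ M k a /ℚ M
χ^-/ℚ zero    a M = refl
χ^-/ℚ (suc k) a M = trans (cong χ (χ^-/ℚ k a M)) (χ-/ℚ (χₙ^ M k a) M)

isInt-χ^⇔∣ : ∀ k a M .{{_ : NonZero M}} → IsInt (χ^ k (a /ℚ M)) ⇔ M ∣ χₙ^ M k a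
isInt-χ^⇔∣ k a M = subst (λ x → IsInt x ⇔ M ∣ χₙ^ M k a) (sym (χ^-/ℚ k a M)) (isInt-/ℚ⇔∣ (χₙ^ M k a) M)

χ^-χ : ∀ k x → χ^ k (χ x) ≡ χ^ (suc k) x
χ^-χ zero    x = refl
χ^-χ (suc k) x = cong χ (χ^-χ k x)

ordIs-suc : ∀ x m → OrdIs x (suc m) ⇔ (¬ IsInt x × OrdIs (χ x) m)
ordIs-suc x m = mk⇔ to from
  where
  to : OrdIs x (suc m) → ¬ IsInt x × OrdIs (χ x) m
  to (int , notInt) = notInt Fin.zero , subst IsInt (sym (χ^-χ m x)) int ,
    λ k → subst (¬_ ∘ IsInt) (sym (χ^-χ (toℕ k) x)) (notInt (Fin.suc k))
  from : ¬ IsInt x × OrdIs (χ x) m → OrdIs x (suc m)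
  from (notInt₀ , int , notInt) = subst IsInt (χ^-χ m x) int ,
    λ { Fin.zero → notInt₀ ; (Fin.suc k) → subst (¬_ ∘ IsInt) (χ^-χ (toℕ k) x) (notInt k) }

ordIs-resp : ∀ {x y} m → (∀ k → k ≤ m → IsInt (χ^ k x) ⇔ IsInt (χ^ k y)) → OrdIs x m → OrdIs y m
ordIs-resp m int⇔ (int , notInt) =
  Equivalence.to (int⇔ m ≤-refl) int ,
  λ k → notInt k ∘ Equivalence.from (int⇔ (toℕ k) (<⇒≤ (Fin.toℕ<n k)))

module _ (d : ℕ) .{{_ : NonZero d}} where

  χₙ-shift : ∀ D b t → Σ[ t′ ∈ ℕ ] χₙ d (b + t * (d * D)) ≡ χₙ d b + t′ * D
  χₙ-shift D b t = t * (b + d * c + t * (d * D)) , expansion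
    where
    c : ℕ
    c = ceilDiv b d
    ceilDiv≡ : ceilDiv (b + t * (d * D)) d ≡ c + t * D
    ceilDiv≡ = ceilDiv-unique
      (subst (λ x → IsCeil (b + x) d (c + t * D)) (*-assoc t D d ⟨ trans ⟩ cong (t *_) (*-comm D d))
             (isCeil-+ {c = c} (t * D) (isCeil-ceilDiv b d)))
    ring : ∀ b c t d D → (b + t * (d * D)) * (c + t * D) ≡ b * c + t * (b + d * c + t * (d * D)) * D
    ring = solve-∀
    expansion : χₙ d (b + t * (d * D)) ≡ χₙ d b + t * (b + d * c + t * (d * D)) * D
    expansion = trans (cong ((b + t * (d * D)) *_) ceilDiv≡) (ring b c t d D)

  χₙ^-shift : ∀ k j b t → Σ[ t′ ∈ ℕ ] χₙ^ d k (b + t * d ^ (k + j)) ≡ χₙ^ d k b + t′ * d ^ j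
  χₙ^-shift zero    j b t = t , refl
  χₙ^-shift (suc k) j b t =
    let t″ , eq = χₙ^-shift k (suc j) b t
        t′ , eq′ = χₙ-shift (d ^ j) (χₙ^ d k b) t″
    in t′ , trans (cong (λ e → χₙ d (χₙ^ d k (b + t * d ^ e))) (sym (+-suc k j)))
                  (trans (cong (χₙ d) eq) eq′)

  ∣χₙ^-shift⇔ : ∀ m b t k → k ≤ m → d ∣ χₙ^ d k (b + t * d ^ suc m) ⇔ d ∣ χₙ^ d k b
  ∣χₙ^-shift⇔ m b t k k≤m with j , refl ← m≤n⇒∃[o]m+o≡n k≤m =
    let t′ , eq = χₙ^-shift k (suc j) b t in
    subst (λ x → d ∣ x ⇔ d ∣ χₙ^ d k b)
          (sym (trans (cong (λ e → χₙ^ d k (b + t * d ^ e)) (sym (+-suc k j))) eq))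
          (∣-+-∣⇔ (∣n⇒∣m*n t′ (m∣m*n (d ^ j))))

  ordIs-periodic : ∀ m b t → OrdIs ((b + t * d ^ suc m) /ℚ d) m ⇔ OrdIs (b /ℚ d) m
  ordIs-periodic m b t = mk⇔ (ordIs-resp m int⇔) (ordIs-resp m (⇔.sym ∘₂ int⇔))
    where
    int⇔ : ∀ k → k ≤ m → IsInt (χ^ k ((b + t * d ^ suc m) /ℚ d)) ⇔ IsInt (χ^ k (b /ℚ d))
    int⇔ k k≤m =
      isInt-χ^⇔∣ k _ d ⟨ ⇔.trans ⟩ ∣χₙ^-shift⇔ m b t k k≤m ⟨ ⇔.trans ⟩ ⇔.sym (isInt-χ^⇔∣ k b d)

-- Numerators of χ(a/M) over one divisor class

module Numerators (k h s m : ℕ) (s⊥d : Coprime s (suc k)) where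

  d g p : ℕ
  d = suc k
  g = suc h
  p = d ^ suc m

  instance
    p≢0 : NonZero p
    p≢0 = m^n≢0 d (suc m)

  d∣p : d ∣ p
  d∣p = m∣m*n (d ^ m)

  -- With M = g d and q = i g + h, so that q + 1 = (i + 1) g, χ((q M + s)/M) = w i / d.
  w : ℕ → ℕ
  w i = ((i * g + h) * (g * d) + s) * suc i

  u : ℕ → ℕ → ℕ
  u i e = (g * d) * (g * (i + i + 1 + e) + h) + s

  w-+ : ∀ i e → w (i + e) ≡ w i + e * u i e
  w-+ i e = ring i e h d s
    where
    ring : ∀ i e h d s → (((i + e) * suc h + h) * (suc h * d) + s) * suc (i + e)
                       ≡ ((i * suc h + h) * (suc h * d) + s) * suc i
                         + e * ((suc h * d) * (suc h * (i + i + 1 + e) + h) + s)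
    ring = solve-∀

  w-%-periodic : ∀ i → w (p + i) % p ≡ w i % p
  w-%-periodic i = trans (cong (_% p) (ring i p h d s)) ([m+kn]%n≡m%n (w i) (a + g * (g * d) * (suc i + p)) p)
    where
    a : ℕ
    a = (i * g + h) * (g * d) + s
    ring : ∀ i p h d s → (((p + i) * suc h + h) * (suc h * d) + s) * suc (p + i)
                       ≡ ((i * suc h + h) * (suc h * d) + s) * suc i
                         + (((i * suc h + h) * (suc h * d) + s) + suc h * (suc h * d) * (suc i + p)) * p
    ring = solve-∀

  *gd+s⊥d : ∀ x → Coprime (x * (g * d) + s) d
  *gd+s⊥d x = subst (λ y → Coprime y d) (trans (+-comm s _) (cong (_+ s) (*-assoc x g d)))
                    (coprime-+-∣ (∣n⇒∣m*n (x * g) ∣-refl) s⊥d)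

  u⊥d : ∀ i e → Coprime (u i e) d
  u⊥d i e = subst (λ y → Coprime y d) (cong (_+ s) (*-comm _ (g * d))) (*gd+s⊥d (g * (i + i + 1 + e) + h))

  w⊥d⇔ : ∀ i → Coprime (w i) d ⇔ Coprime (suc i) d
  w⊥d⇔ i = mk⇔ (coprime-*-factorʳ {(i * g + h) * (g * d) + s}) (coprime-*ˡ (*gd+s⊥d (i * g + h)))

  w-%-≢ : ∀ {i j} → i < j → j < p → w j % p ≢ w i % p
  w-%-≢ {i} {j} i<j j<p eq = <-irrefl refl (<-≤-trans j<p (begin
    p  ≤⟨ ∣⇒≤ p∣e ⟩
    e  ≤⟨ m∸n≤m j i ⟩
    j  ∎))
    where
    open ≤-Reasoning
    e : ℕ
    e = j ∸ i
    instance
      e≢0 : NonZero e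
      e≢0 = >-nonZero (m<n⇒0<n∸m i<j)
    p∣eu : p ∣ e * u i e
    p∣eu = [m+n]%o≡m%o⇒o∣n (w i) (e * u i e) p
             (trans (cong (_% p) (trans (sym (w-+ i e)) (cong w (m+[n∸m]≡n (<⇒≤ i<j))))) eq)
    p∣e : p ∣ e
    p∣e = Coprime.coprime-divisor (Coprime.sym (coprime-^ʳ (suc m) (u⊥d i e)))
                                  (subst (p ∣_) (*-comm e _) p∣eu)

  w-%-injective : ∀ {i j} → i < p → j < p → w i % p ≡ w j % p → i ≡ j
  w-%-injective {i} {j} i<p j<p eq with <-cmp i j
  ... | tri< i<j _ _ = contradiction (sym eq) (w-%-≢ i<j j<p)
  ... | tri≈ _ i≡j _ = i≡j
  ... | tri> _ _ j<i = contradiction eq (w-%-≢ j<i i<p)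

  Good : ℕ → Set
  Good i = Coprime (suc i) d × OrdIs (w i /ℚ d) m

  good? : Decidable Good
  good? i = coprime? (suc i) d ×-dec ordIs? (w i /ℚ d) m

  good⇔inA : ∀ i → Good i ⇔ InA m d (w i % p)
  good⇔inA i = ⇔.sym ((coprime-%⇔ p d∣p ⟨ ⇔.trans ⟩ w⊥d⇔ i) ×-⇔ ordIs-%⇔)
    where
    ordIs-%⇔ : OrdIs ((w i % p) /ℚ d) m ⇔ OrdIs (w i /ℚ d) m
    ordIs-%⇔ = subst (λ x → OrdIs ((w i % p) /ℚ d) m ⇔ OrdIs (x /ℚ d) m) (sym (m≡m%n+[m/n]*n (w i) p))
                     (⇔.sym (ordIs-periodic d m (w i % p) (w i / p)))

  ∑-good : ∑[ i < p ] 𝟙 (good? i) ≡ A m d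
  ∑-good = begin
    ∑[ i < p ] 𝟙 (good? i)              ≡⟨ ∑-cong p (λ i _ → 𝟙-cong (good? i) (inA? m d (w i % p)) (good⇔inA i)) ⟩
    count (inA? m d ∘ λ i → w i % p) p  ≡⟨ count-∘-permutation (inA? m d) (λ i → w i % p) p
                                             (λ i _ → m%n<n (w i) p) (λ _ _ → w-%-injective) ⟩
    count (inA? m d) p                  ≡⟨ length-filter-applyUpTo (inA? m d) id p ⟨
    A m d                               ∎
    where open ≡-Reasoning

  ∑-good-periods : ∀ K → ∑[ i < K * p ] 𝟙 (good? i) ≡ K * A m d
  ∑-good-periods K = trans (∑-periodic K p (𝟙 ∘ good?) good-periodic) (cong (K *_) ∑-good)
    where
    good-periodic : ∀ i → 𝟙 (good? (p + i)) ≡ 𝟙 (good? i)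
    good-periodic i = 𝟙-cong (good? (p + i)) (good? i) (good⇔inA (p + i) ⟨ ⇔.trans ⟩
      subst (λ x → InA m d x ⇔ Good i) (sym (w-%-periodic i)) (⇔.sym (good⇔inA i)))

-- The recursion

module Residue (M : ℕ) .{{_ : NonZero M}} (m s : ℕ) where

  ξ : ℕ → ℚ
  ξ q = ((q * M + s) * suc q) /ℚ M

  χ-qM+s : ∀ q → 0 < s → s ≤ M → χ ((q * M + s) /ℚ M) ≡ ξ q
  χ-qM+s q 0<s s≤M = trans (χ-/ℚ (q * M + s) M)
    (cong (λ c → ((q * M + s) * c) /ℚ M) (ceilDiv-unique (isCeil-suc q 0<s s≤M)))

  ¬isInt-qM+s : ∀ q → 0 < s → s < M → ¬ IsInt ((q * M + s) /ℚ M)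
  ¬isInt-qM+s q 0<s s<M int = <-irrefl refl (<-≤-trans s<M (∣⇒≤ {{>-nonZero 0<s}} M∣s))
    where
    M∣s : M ∣ s
    M∣s = ∣m+n∣m⇒∣n (Equivalence.to (isInt-/ℚ⇔∣ (q * M + s) M) int) (n∣m*n q)

  ordIs-suc-qM+s : ∀ q → 0 < s → s < M → OrdIs ((q * M + s) /ℚ M) (suc m) ⇔ OrdIs (ξ q) m
  ordIs-suc-qM+s q 0<s s<M = ordIs-suc _ m ⟨ ⇔.trans ⟩ mk⇔
    (λ (_ , ord) → subst (λ x → OrdIs x m) (χ-qM+s q 0<s (<⇒≤ s<M)) ord)
    (λ ord → ¬isInt-qM+s q 0<s s<M , subst (λ x → OrdIs x m) (sym (χ-qM+s q 0<s (<⇒≤ s<M))) ord)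

  -- Divisors of M are written suc k, as in divisorSum; q falls in the class of suc k when
  -- M / gcd(q + 1, M) = suc k.
  InClass : ℕ → ℕ → Set
  InClass k q = suc k * gcd (suc q) M ≡ M × OrdIs (ξ q) m

  inClass? : ∀ k → Decidable (InClass k)
  inClass? k q = (suc k * gcd (suc q) M ≟ M) ×-dec ordIs? (ξ q) m

  module DivisorClass (k h : ℕ) (M≡gd : M ≡ suc h * suc k) (s⊥M : Coprime s M) where

    open Numerators k h s m (coprime-∣ʳ (subst (suc k ∣_) (sym M≡gd) (n∣m*n (suc h))) s⊥M)

    M≡dg : M ≡ d * g
    M≡dg = trans M≡gd (*-comm g d)

    inClass⇔gcd≡g : ∀ q → suc k * gcd (suc q) M ≡ M ⇔ gcd (suc q) M ≡ g
    inClass⇔gcd≡g q = mk⇔ (λ eq → *-cancelˡ-≡ _ g d (trans eq M≡dg)) (λ eq → trans (cong (d *_) eq) (sym M≡dg))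

    class-off : ∀ i j → j < g → j ≢ h → 𝟙 (inClass? k (i * g + j)) ≡ 0
    class-off i j j<g j≢h =
      𝟙-no (inClass? k (i * g + j)) λ (eq , _) → g∤1+j (g∣1+j (Equivalence.to (inClass⇔gcd≡g _) eq))
      where
      g∣1+j : gcd (suc (i * g + j)) M ≡ g → g ∣ suc j
      g∣1+j gcd≡g = ∣m+n∣m⇒∣n
        (subst (g ∣_) (sym (+-suc (i * g) j)) (subst (_∣ suc (i * g + j)) gcd≡g (gcd[m,n]∣m (suc (i * g + j)) M)))
        (n∣m*n i)
      g∤1+j : ¬ g ∣ suc j
      g∤1+j g∣1+j = j≢h (≤-antisym (s≤s⁻¹ j<g) (s≤s⁻¹ (∣⇒≤ g∣1+j)))

    1+[i*g+h]≡[1+i]*g : ∀ i → suc (i * g + h) ≡ suc i * g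
    1+[i*g+h]≡[1+i]*g i = ring i h
      where
      ring : ∀ i h → suc (i * suc h + h) ≡ suc i * suc h
      ring = solve-∀

    ξ≡w/d : ∀ i → ξ (i * g + h) ≡ w i /ℚ d
    ξ≡w/d i = /ℚ-cross ((q * M + s) * suc q) (w i) M d
                       (subst (λ M → ((q * M + s) * suc q) * d ≡ w i * M) (sym M≡gd) cross)
      where
      q : ℕ
      q = i * g + h
      ring : ∀ a i g d → (a * (i * g)) * d ≡ (a * i) * (g * d)
      ring = solve-∀
      cross : ((q * (g * d) + s) * suc q) * d ≡ w i * (g * d)
      cross = trans (cong (λ x → ((q * (g * d) + s) * x) * d) (1+[i*g+h]≡[1+i]*g i))
                    (ring (q * (g * d) + s) (suc i) g d)

    class-on : ∀ i → 𝟙 (inClass? k (i * g + h)) ≡ 𝟙 (good? i)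
    class-on i = 𝟙-cong (inClass? k q) (good? i)
                        (gcd⇔ ×-⇔ subst (λ x → OrdIs (ξ q) m ⇔ OrdIs x m) (ξ≡w/d i) ⇔.refl)
      where
      q : ℕ
      q = i * g + h
      gcd⇔ : suc k * gcd (suc q) M ≡ M ⇔ Coprime (suc i) d
      gcd⇔ = inClass⇔gcd≡g q ⟨ ⇔.trans ⟩
             subst₂ (λ x y → gcd x y ≡ g ⇔ Coprime (suc i) d) (sym (1+[i*g+h]≡[1+i]*g i)) (sym M≡dg)
                    (gcd[m*g,n*g]≡g⇔coprime (suc i) d g)

    M^[1+m]≡g^m*p*g : M ^ suc m ≡ g ^ m * p * g
    M^[1+m]≡g^m*p*g =
      trans (cong (_^ suc m) M≡gd) (trans (^-distrib-* g d (suc m)) (ring (g ^ m) g (d ^ suc m)))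
      where
      ring : ∀ x g y → (g * x) * y ≡ x * y * g
      ring = solve-∀

    ∑-class : ∑[ q < M ^ suc m ] 𝟙 (inClass? k q) ≡ A m d * g ^ m
    ∑-class = begin
      ∑[ q < M ^ suc m ] 𝟙 (inClass? k q)
        ≡⟨ cong (λ n → ∑< n (𝟙 ∘ inClass? k)) M^[1+m]≡g^m*p*g ⟩
      ∑[ q < g ^ m * p * g ] 𝟙 (inClass? k q)
        ≡⟨ ∑-blocks (g ^ m * p) g _ ⟩
      ∑[ i < g ^ m * p ] ∑[ j < g ] 𝟙 (inClass? k (i * g + j))
        ≡⟨ ∑-cong (g ^ m * p) (λ i _ → ∑-single g h _ ≤-refl (class-off i)) ⟩
      ∑[ i < g ^ m * p ] 𝟙 (inClass? k (i * g + h))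
        ≡⟨ ∑-cong (g ^ m * p) (λ i _ → class-on i) ⟩
      ∑[ i < g ^ m * p ] 𝟙 (good? i)
        ≡⟨ ∑-good-periods (g ^ m) ⟩
      g ^ m * A m d
        ≡⟨ *-comm (g ^ m) (A m d) ⟩
      A m d * g ^ m
        ∎
      where open ≡-Reasoning

  gcd-cofactor : ∀ n → Σ[ k ∈ ℕ ] M ≡ suc k * gcd n M
  gcd-cofactor n with gcd[m,n]∣n n M
  ... | divides zero    M≡0 = contradiction M≡0 (≢-nonZero⁻¹ M)
  ... | divides (suc k) M≡  = k , M≡

  class-unique : ∀ q → ∑[ k < M ] 𝟙 (inClass? k q) ≡ 𝟙 (ordIs? (ξ q) m)
  class-unique q = trans (∑-single M k (λ k′ → 𝟙 (inClass? k′ q)) k<M others) on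
    where
    k : ℕ
    k = proj₁ (gcd-cofactor (suc q))
    M≡ : M ≡ suc k * gcd (suc q) M
    M≡ = proj₂ (gcd-cofactor (suc q))
    instance
      gcd≢0 : NonZero (gcd (suc q) M)
      gcd≢0 = ≢-nonZero (gcd[m,n]≢0 (suc q) M (inj₂ (≢-nonZero⁻¹ M)))
    on : 𝟙 (inClass? k q) ≡ 𝟙 (ordIs? (ξ q) m)
    on = 𝟙-cong (inClass? k q) (ordIs? (ξ q) m) (proj₂-⇔ (sym M≡))
    k<M : k < M
    k<M = ∣⇒≤ (divides (gcd (suc q) M) (trans M≡ (*-comm (suc k) _)))
    others : ∀ k′ → k′ < M → k′ ≢ k → 𝟙 (inClass? k′ q) ≡ 0
    others k′ _ k′≢k = 𝟙-no (inClass? k′ q)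
      (λ (eq , _) → k′≢k (suc-injective (*-cancelʳ-≡ _ _ (gcd (suc q) M) (trans eq M≡))))

  ∑-class-∣ : Coprime s M → ∀ k → suc k ∣ M →
    ∑[ q < M ^ suc m ] 𝟙 (inClass? k q) ≡ A m (suc k) * (M / suc k) ^ m
  ∑-class-∣ s⊥M k (divides zero    M≡0) = contradiction M≡0 (≢-nonZero⁻¹ M)
  ∑-class-∣ s⊥M k (divides (suc h) M≡)  = trans (DivisorClass.∑-class k h M≡ s⊥M)
    (cong (λ g → A m (suc k) * g ^ m) (sym (trans (cong (_/ suc k) M≡) (m*n/n≡m (suc h) (suc k)))))

  ∑-class-∤ : ∀ k → ¬ suc k ∣ M → ∑[ q < M ^ suc m ] 𝟙 (inClass? k q) ≡ 0
  ∑-class-∤ k d∤M = ∑-zero (M ^ suc m) λ q _ →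
    𝟙-no (inClass? k q) (λ (eq , _) → d∤M (divides (gcd (suc q) M) (trans (sym eq) (*-comm (suc k) _))))

  ∑-class : Coprime s M → ∀ k →
    ∑[ q < M ^ suc m ] 𝟙 (inClass? k q) ≡ 𝟙 (suc k ∣? M) * (A m (suc k) * (M / suc k) ^ m)
  ∑-class s⊥M k = by-cases (suc k ∣? M)
    where
    by-cases : (d∣?M : Dec (suc k ∣ M)) →
      ∑[ q < M ^ suc m ] 𝟙 (inClass? k q) ≡ 𝟙 d∣?M * (A m (suc k) * (M / suc k) ^ m)
    by-cases (yes d∣M) = trans (∑-class-∣ s⊥M k d∣M) (sym (+-identityʳ _))
    by-cases (no d∤M)  = ∑-class-∤ k d∤M

  ∑-ordIs-ξ : Coprime s M → ∑[ q < M ^ suc m ] 𝟙 (ordIs? (ξ q) m) ≡ divisorSum (suc m) M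
  ∑-ordIs-ξ s⊥M = begin
    ∑[ q < M ^ suc m ] 𝟙 (ordIs? (ξ q) m)
      ≡⟨ ∑-cong (M ^ suc m) (λ q _ → class-unique q) ⟨
    ∑[ q < M ^ suc m ] ∑[ k < M ] 𝟙 (inClass? k q)
      ≡⟨ ∑-swap (M ^ suc m) M (λ q k → 𝟙 (inClass? k q)) ⟩
    ∑[ k < M ] ∑[ q < M ^ suc m ] 𝟙 (inClass? k q)
      ≡⟨ ∑-cong M (λ k _ → ∑-class s⊥M k) ⟩
    ∑[ k < M ] 𝟙 (suc k ∣? M) * (A m (suc k) * (M / suc k) ^ m)
      ≡⟨ sum-map-filter-applyUpTo (λ k → suc k ∣? M) _ id M ⟨
    divisorSum (suc m) M
      ∎
    where open ≡-Reasoning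

module _ (M : ℕ) .{{_ : NonZero M}} (1<M : 1 < M) (m : ℕ) where

  open Residue M m

  coprime⇒0< : ∀ {s} → Coprime s M → 0 < s
  coprime⇒0< {zero}  0⊥M = contradiction (Coprime.0-coprimeTo-m⇒m≡1 0⊥M) (>⇒≢ 1<M)
  coprime⇒0< {suc s} _   = z<s

  coprime-qM+s⇔ : ∀ q s → Coprime (q * M + s) M ⇔ Coprime s M
  coprime-qM+s⇔ q s = subst (λ x → Coprime x M ⇔ Coprime s M) (+-comm s (q * M))
    (mk⇔ (coprime-+-∣⁻¹ {s} (n∣m*n q)) (coprime-+-∣ (n∣m*n q)))

  inA-qM+s⇔ : ∀ q {s} → s < M → InA (suc m) M (q * M + s) ⇔ (Coprime s M × OrdIs (ξ s q) m)
  inA-qM+s⇔ q {s} s<M = mk⇔ to from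
    where
    to : InA (suc m) M (q * M + s) → Coprime s M × OrdIs (ξ s q) m
    to (qM+s⊥M , ord) = let s⊥M = Equivalence.to (coprime-qM+s⇔ q s) qM+s⊥M in
      s⊥M , Equivalence.to (ordIs-suc-qM+s s q (coprime⇒0< s⊥M) s<M) ord
    from : Coprime s M × OrdIs (ξ s q) m → InA (suc m) M (q * M + s)
    from (s⊥M , ord) = Equivalence.from (coprime-qM+s⇔ q s) s⊥M ,
                       Equivalence.from (ordIs-suc-qM+s s q (coprime⇒0< s⊥M) s<M) ord

  ∑-residue-coprime : ∀ {s} → s < M → Coprime s M →
    ∑[ q < M ^ suc m ] 𝟙 (inA? (suc m) M (q * M + s)) ≡ divisorSum (suc m) M
  ∑-residue-coprime {s} s<M s⊥M = trans (∑-cong (M ^ suc m) λ q _ →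
      𝟙-cong (inA? (suc m) M (q * M + s)) (ordIs? (ξ s q) m)
             (inA-qM+s⇔ q s<M ⟨ ⇔.trans ⟩ proj₂-⇔ {X = Coprime s M} s⊥M))
    (∑-ordIs-ξ s s⊥M)

  ∑-residue-¬coprime : ∀ {s} → s < M → ¬ Coprime s M → ∑[ q < M ^ suc m ] 𝟙 (inA? (suc m) M (q * M + s)) ≡ 0
  ∑-residue-¬coprime {s} s<M ¬s⊥M = ∑-zero (M ^ suc m) λ q _ →
    𝟙-no (inA? (suc m) M (q * M + s)) (¬s⊥M ∘ proj₁ ∘ Equivalence.to (inA-qM+s⇔ q s<M))

  ∑-residue : ∀ s → s < M →
    ∑[ q < M ^ suc m ] 𝟙 (inA? (suc m) M (q * M + s)) ≡ 𝟙 (coprime? s M) * divisorSum (suc m) M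
  ∑-residue s s<M = by-cases (coprime? s M)
    where
    by-cases : (s⊥?M : Dec (Coprime s M)) →
      ∑[ q < M ^ suc m ] 𝟙 (inA? (suc m) M (q * M + s)) ≡ 𝟙 s⊥?M * divisorSum (suc m) M
    by-cases (yes s⊥M)  = trans (∑-residue-coprime s<M s⊥M) (sym (+-identityʳ _))
    by-cases (no ¬s⊥M) = ∑-residue-¬coprime s<M ¬s⊥M

  φ≡count : φ M ≡ count (λ s → coprime? s M) M
  φ≡count = begin
    φ M                                                     ≡⟨ cong (length ∘ filter (λ s → coprime? s M))
                                                                    (map-applyUpTo id suc M) ⟩
    length (filter (λ s → coprime? s M) (applyUpTo suc M))  ≡⟨ length-filter-applyUpTo (λ s → coprime? s M) suc M ⟩
    ∑[ i < M ] 𝟙 (coprime? (suc i) M)                       ≡⟨ ∑-rotate M (λ s → 𝟙 (coprime? s M)) 𝟙[M⊥M]≡𝟙[0⊥M] ⟩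
    count (λ s → coprime? s M) M                            ∎
    where
    open ≡-Reasoning
    𝟙[M⊥M]≡𝟙[0⊥M] : 𝟙 (coprime? M M) ≡ 𝟙 (coprime? 0 M)
    𝟙[M⊥M]≡𝟙[0⊥M] = trans (𝟙-no (coprime? M M) (λ M⊥M → >⇒≢ 1<M (M⊥M (∣-refl , ∣-refl))))
                          (sym (𝟙-no (coprime? 0 M) (>⇒≢ 1<M ∘ Coprime.0-coprimeTo-m⇒m≡1)))

  A-suc : A (suc m) M ≡ φ M * divisorSum (suc m) M
  A-suc = begin
    A (suc m) M                               ≡⟨ length-filter-applyUpTo P? id (M * N) ⟩
    ∑[ a < M * N ] 𝟙 (P? a)                   ≡⟨ cong (count P?) (*-comm M N) ⟩
    ∑[ a < N * M ] 𝟙 (P? a)                   ≡⟨ ∑-blocks N M (𝟙 ∘ P?) ⟩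
    ∑[ q < N ] ∑[ s < M ] 𝟙 (P? (q * M + s))  ≡⟨ ∑-swap N M (λ q s → 𝟙 (P? (q * M + s))) ⟩
    ∑[ s < M ] ∑[ q < N ] 𝟙 (P? (q * M + s))  ≡⟨ ∑-cong M ∑-residue ⟩
    ∑[ s < M ] 𝟙 (coprime? s M) * D           ≡⟨ ∑-distribʳ-* M D (λ s → 𝟙 (coprime? s M)) ⟩
    count (λ s → coprime? s M) M * D          ≡⟨ cong (_* D) φ≡count ⟨
    φ M * D                                   ∎
    where
    open ≡-Reasoning
    P? : Decidable (InA (suc m) M)
    P? = inA? (suc m) M
    N D : ℕ
    N = M ^ suc m
    D = divisorSum (suc m) M

A[1+n,1]≡0 : ∀ n → A (suc n) 1 ≡ 0
A[1+n,1]≡0 n = trans (length-filter-applyUpTo (inA? (suc n) 1) id (1 ^ suc (suc n)))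
  (∑-zero (1 ^ suc (suc n)) λ a _ → 𝟙-no (inA? (suc n) 1 a) λ (_ , ord) →
    proj₁ (Equivalence.to (ordIs-suc (a /ℚ 1) n) ord) (Equivalence.from (isInt-/ℚ⇔∣ a 1) (1∣ a)))

divisorSum[2+n,1]≡0 : ∀ n → divisorSum (suc (suc n)) 1 ≡ 0
divisorSum[2+n,1]≡0 n = cong (λ a → a * 1 ^ suc n + 0) (A[1+n,1]≡0 n)

theorem2p3 : (n M : ℕ) → .{{_ : NonZero M}} → 1 ≤ n → (1 < M ⊎ 1 < n) →
    A n M ≡ φ M * divisorSum n M
theorem2p3 (suc m)       M@(suc (suc _)) _ _ = A-suc M (s<s z<s) m
theorem2p3 (suc (suc n)) 1               _ _ =
  trans (A[1+n,1]≡0 (suc n)) (sym (cong (φ 1 *_) (divisorSum[2+n,1]≡0 n)))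
theorem2p3 1             1               _ (inj₁ (s<s ()))
theorem2p3 1             1               _ (inj₂ (s<s ()))
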